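{- There are infinitely many positive integers $n$ for which \[ \max \{ {\rm sfp}(n), {\rm sfp}(n+1), {\rm sfp}(n+2) \} < n^{1/3}. \]
   Context: For a positive integer $m$, ${\rm sfp}(m)$ (the squarefree part of $m$) denotes the smallest positive integer $a$ such that $a \mid m$ and $m/a$ is a perfect square. -}

module Defs where

open import Data.Nat using (ℕ; _*_; _≤_; _<_; _⊔_; _^_)
open import Data.Nat.Divisibility using (_∣_)
open import Data.Product using (_×_; ∃-syntax)
open import Relation.Binary.PropositionalEquality using (_≡_)

IsSquare : ℕ → Set
IsSquare k = ∃[ j ] (j * j ≡ k)

SquareCofactor : ℕ → ℕ → Set
SquareCofactor m a = a ∣ m × ∃[ q ] (m ≡ a * q × IsSquare q)

IsSfp : ℕ → ℕ → Set
IsSfp m a = 1 ≤ a × SquareCofactor m a × (∀ b → 1 ≤ b → SquareCofactor m b → a ≤ b)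

-- With n = m(2m+3)² one has n + 2 = (m+2)(2m+1)², so sfp n ≤ m and sfp (n+2) ≤ m+2, while
-- n > (m+2)³ once m ≥ 2. If moreover m + 1 = 27c, then n + 1 = 4(m+1)³ − 3(m+1) = 81c(972c² − 1),
-- so each solution of the Pell equation 972c² − 11t² = 1 gives n + 1 = 11c(9t)² with 11c ≤ m+2.
-- Starting from (c, t) = (5, 47), that Pell equation has arbitrarily large solutions.
module Submission where

open import Defs
open import Data.Nat using (ℕ; zero; suc; _+_; _*_; _<_; _≤_; _⊔_; _^_; s≤s; z≤n; >-nonZero)
open import Data.Nat.Divisibility using (divides)
open import Data.Nat.Properties
open import Data.Nat.Tactic.RingSolver using (solve-∀; solve)
open import Data.List using (_∷_; [])
open import Data.Product using (_×_; _,_; ∃-syntax)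
open import Relation.Binary.PropositionalEquality
open ≡-Reasoning

squareCofactor : ∀ {m} a q → m ≡ a * (q * q) → SquareCofactor m a
squareCofactor a q m≡aq² = divides (q * q) (trans m≡aq² (*-comm a (q * q))) , q * q , m≡aq² , q , refl

sfp≤ : ∀ {m a} → IsSfp m a → ∀ b q → 1 ≤ b → m ≡ b * (q * q) → a ≤ b
sfp≤ (_ , _ , minimal) b q 1≤b m≡bq² = minimal b 1≤b (squareCofactor b q m≡bq²)

m[2m+3]²+2≡[m+2][2m+1]² : ∀ m → m * ((2 * m + 3) * (2 * m + 3)) + 2 ≡ (m + 2) * ((2 * m + 1) * (2 * m + 1))
m[2m+3]²+2≡[m+2][2m+1]² = solve-∀

[m+2]³<m[2m+3]² : ∀ m → 2 ≤ m → (m + 2) ^ 3 < m * ((2 * m + 3) * (2 * m + 3))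
[m+2]³<m[2m+3]² m@(suc (suc j)) (s≤s (s≤s z≤n)) =
  subst ((m + 2) ^ 3 <_) (sym (expand j)) (s≤s (m≤m+n ((m + 2) ^ 3) _))
  where
  -- the solver does not accept _^_, so (m + 2) ^ 3 is written in its unfolded form
  expand : ∀ j → (2 + j) * ((2 * (2 + j) + 3) * (2 * (2 + j) + 3))
               ≡ suc ((2 + j + 2) * ((2 + j + 2) * ((2 + j + 2) * 1)) + (3 * (j * j * j) + 24 * (j * j) + 57 * j + 33))
  expand = solve-∀

PellSolution : ℕ → ℕ → Set
PellSolution c t = 972 * (c * c) ≡ 11 * (t * t) + 1

m[2m+3]²+1≡11c[9t]² : ∀ m c t → m + 1 ≡ 27 * c → PellSolution c t →
                       m * ((2 * m + 3) * (2 * m + 3)) + 1 ≡ 11 * c * ((9 * t) * (9 * t))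
m[2m+3]²+1≡11c[9t]² m c t m+1≡27c pell = +-cancelʳ-≡ (81 * c) _ _ (begin
  m * ((2 * m + 3) * (2 * m + 3)) + 1 + 81 * c       ≡⟨ cong (m * ((2 * m + 3) * (2 * m + 3)) + 1 +_) 81c≡3[m+1] ⟩
  m * ((2 * m + 3) * (2 * m + 3)) + 1 + 3 * (m + 1)  ≡⟨ solve (m ∷ []) ⟩
  4 * ((m + 1) * (m + 1) * (m + 1))                   ≡⟨ cong (λ x → 4 * (x * x * x)) m+1≡27c ⟩
  4 * (27 * c * (27 * c) * (27 * c))                  ≡⟨ solve (c ∷ []) ⟩
  81 * c * (972 * (c * c))                            ≡⟨ cong (81 * c *_) pell ⟩
  81 * c * (11 * (t * t) + 1)                         ≡⟨ solve (c ∷ t ∷ []) ⟩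
  11 * c * ((9 * t) * (9 * t)) + 81 * c               ∎)
  where
  81c≡3[m+1] : 81 * c ≡ 3 * (m + 1)
  81c≡3[m+1] = trans (*-assoc 3 27 c) (cong (3 *_) (sym m+1≡27c))

-- multiplication of c√972 + t√11 by the unit 48599 + 470√10692
pellSolution-step : ∀ c t → PellSolution c t → PellSolution (48599 * c + 5170 * t) (456840 * c + 48599 * t)
pellSolution-step c t pell = +-cancelʳ-≡ (11 * (t * t)) _ _ (begin
  972 * ((48599 * c + 5170 * t) * (48599 * c + 5170 * t)) + 11 * (t * t)
    ≡⟨ solve (c ∷ t ∷ []) ⟩
  11 * ((456840 * c + 48599 * t) * (456840 * c + 48599 * t)) + 972 * (c * c)
    ≡⟨ cong (11 * ((456840 * c + 48599 * t) * (456840 * c + 48599 * t)) +_) pell ⟩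
  11 * ((456840 * c + 48599 * t) * (456840 * c + 48599 * t)) + (11 * (t * t) + 1)
    ≡⟨ solve (c ∷ t ∷ []) ⟩
  11 * ((456840 * c + 48599 * t) * (456840 * c + 48599 * t)) + 1 + 11 * (t * t) ∎)

pellSolution-step-grows : ∀ {c} t → 1 ≤ c → c < 48599 * c + 5170 * t
pellSolution-step-grows {c} t 1≤c = <-≤-trans (m<m*n c 48599 ⦃ >-nonZero 1≤c ⦄ (s≤s (s≤s z≤n)))
  (subst (_≤ 48599 * c + 5170 * t) (*-comm 48599 c) (m≤m+n (48599 * c) (5170 * t)))

pellSolutions-unbounded : ∀ N → ∃[ c ] ∃[ t ] (N < c × PellSolution c t)
pellSolutions-unbounded zero = 5 , 47 , s≤s z≤n , refl
pellSolutions-unbounded (suc N) with pellSolutions-unbounded N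
... | c , t , N<c , pell =
  48599 * c + 5170 * t , 456840 * c + 48599 * t ,
  <-≤-trans (s≤s N<c) (pellSolution-step-grows t (≤-trans (s≤s z≤n) N<c)) , pellSolution-step c t pell

max-sfp³<n : ∀ m c t → 2 ≤ m → 1 ≤ c → m + 1 ≡ 27 * c → PellSolution c t →
  ∀ a b d → IsSfp (m * ((2 * m + 3) * (2 * m + 3))) a
          → IsSfp (m * ((2 * m + 3) * (2 * m + 3)) + 1) b
          → IsSfp (m * ((2 * m + 3) * (2 * m + 3)) + 2) d
          → ((a ⊔ b) ⊔ d) ^ 3 < m * ((2 * m + 3) * (2 * m + 3))
max-sfp³<n m c t 2≤m 1≤c m+1≡27c pell a b d sfp-a sfp-b sfp-d =
  ≤-<-trans (^-monoˡ-≤ 3 (⊔-lub (⊔-lub a≤m+2 b≤m+2) d≤m+2)) ([m+2]³<m[2m+3]² m 2≤m)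
  where
  1≤m : 1 ≤ m
  1≤m = ≤-trans (s≤s z≤n) 2≤m
  a≤m+2 : a ≤ m + 2
  a≤m+2 = ≤-trans (sfp≤ sfp-a m (2 * m + 3) 1≤m refl) (m≤m+n m 2)
  11c≤m+2 : 11 * c ≤ m + 2
  11c≤m+2 = ≤-trans (*-monoˡ-≤ c (m≤m+n 11 16)) (≤-trans (≤-reflexive (sym m+1≡27c)) (+-monoʳ-≤ m (s≤s z≤n)))
  b≤m+2 : b ≤ m + 2
  b≤m+2 = ≤-trans (sfp≤ sfp-b (11 * c) (9 * t) (≤-trans 1≤c (m≤n*m c 11)) (m[2m+3]²+1≡11c[9t]² m c t m+1≡27c pell))
                  11c≤m+2
  d≤m+2 : d ≤ m + 2
  d≤m+2 = sfp≤ sfp-d (m + 2) (2 * m + 1) (≤-trans 1≤m (m≤m+n m 2)) (m[2m+3]²+2≡[m+2][2m+1]² m)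

theorem2 : ∀ (N : ℕ) → ∃[ n ] (N < n × (∀ a b c → IsSfp n a → IsSfp (n + 1) b → IsSfp (n + 2) c → ((a ⊔ b) ⊔ c) ^ 3 < n))
theorem2 N with pellSolutions-unbounded N
... | suc k , t , s≤s N≤k , pell =
  m * ((2 * m + 3) * (2 * m + 3)) , N<n , max-sfp³<n m (suc k) t (s≤s (s≤s z≤n)) (s≤s z≤n) (26+27j+1≡27[1+j] k) pell
  where
  m : ℕ
  m = 26 + 27 * k
  26+27j+1≡27[1+j] : ∀ j → 26 + 27 * j + 1 ≡ 27 * suc j
  26+27j+1≡27[1+j] = solve-∀
  N<m : N < m
  N<m = s≤s (≤-trans N≤k (≤-trans (m≤n*m k 27) (m≤n+m (27 * k) 25)))
  N<n : N < m * ((2 * m + 3) * (2 * m + 3))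
  N<n = <-≤-trans N<m (m≤m*n m ((2 * m + 3) * (2 * m + 3)))
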